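{- Let $\mathcal{H}$ be a connected $m$-uniform hypergraph with at least one edge and $u\in V(\mathcal{H})$. Let $\mathcal{T}$ be a binary $m$-uniform hypertree (disjoint from $\mathcal{H}$) with vertices $v_k,v_n,u_1,u_2$ and edges $e_k,e_{k+1}$ such that $d_{\mathcal{T}}(v_k)=2$, $v_k,u_1\in e_k$, $v_k,u_2\in e_{k+1}$, $u_1,u_2\ne v_k$, $v_n$ is a pendent vertex of $\mathcal{T}$, and $d_{\mathcal{T}}(u_1,v_n)>d_{\mathcal{T}}(u_2,v_n)$. Let $\mathcal{H}_1$ be obtained from $\mathcal{H}$ and $\mathcal{T}$ by identifying $u$ with $v_k$, and let $\mathcal{H}_2$ be obtained from $\mathcal{H}_1$ by deleting $e_k$ and adding $(e_k\setminus\{v_k\})\cup\{v_n\}$. Then $M(\mathcal{H}_1)>M(\mathcal{H}_2)$.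
   Context: $d_{\mathcal{H}}(w)$ is the degree of vertex $w$ (number of edges containing it). An $m$-uniform hypertree is a connected $m$-uniform hypergraph with no (Berge) hypercycle; it is binary if its maximum degree is at most $2$. A core vertex is a vertex of degree one; a pendent edge is an edge $f$ containing $|f|-1$ core vertices; a pendent vertex is a core vertex in a pendent edge. $d_{\mathcal{T}}(x,y)$ is the distance (length of a shortest path) between $x$ and $y$, with $d_{\mathcal{T}}(x,x)=0$. The Zagreb index $M(\mathcal{H})$ is the sum of the squares of the degrees of all vertices. -}

module Defs where

open import Data.Nat using (ℕ; zero; suc; _+_; _*_; _∸_; _≤_; _<_)
open import Data.Bool using (Bool; true; false; _∧_)
open import Data.Fin using (Fin; zero; suc; inject₁; fromℕ; _↑ˡ_; _↑ʳ_) renaming (_≟_ to _≟ᶠ_)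
open import Data.Fin.Subset using (Subset; _∈_; _∉_; ∣_∣; _-_; _∪_; ⁅_⁆)
open import Data.Fin.Subset.Properties using (_∈?_)
open import Data.List using (List; []; _∷_; length; filter; map; lookup; allFin; removeAt; _++_)
open import Data.Nat.ListAction using (sum)
open import Data.Bool.ListAction using (any)
open import Data.List.Relation.Unary.All using (All)
open import Data.List.Relation.Unary.Any using (Any)
open import Data.List.Relation.Unary.Unique.Propositional using (Unique)
open import Data.Vec using (Vec; tabulate; replicate) renaming (_++_ to _++ᵥ_; lookup to lookupᵥ)
open import Data.Product using (Σ; ∃; ∃-syntax; _×_; _,_)
open import Relation.Binary.PropositionalEquality using (_≡_; _≢_)
open import Relation.Nullary using (¬_)
open import Relation.Nullary.Decidable using (⌊_⌋; _×-dec_)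
open import Function.Definitions using (Injective)

Hypergraph : ℕ → Set
Hypergraph n = List (Subset n)

Simple : ∀ {n} → Hypergraph n → Set
Simple E = Unique E

Uniform : ∀ {n} → ℕ → Hypergraph n → Set
Uniform m E = All (λ e → ∣ e ∣ ≡ m) E

deg : ∀ {n} → Hypergraph n → Fin n → ℕ
deg E w = length (filter (λ e → w ∈? e) E)

Zagreb : ∀ {n} → Hypergraph n → ℕ
Zagreb {n} E = sum (map (λ w → deg E w * deg E w) (allFin n))

data Walk {n} (E : Hypergraph n) : Fin n → Fin n → ℕ → Set where
  here : ∀ {x} → Walk E x x 0
  step : ∀ {x y z l} (e : Subset n) → Any (e ≡_) E → x ∈ e → y ∈ e →
         Walk E y z l → Walk E x z (suc l)

Connected : ∀ {n} → Hypergraph n → Set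
Connected {n} E = (x y : Fin n) → ∃[ l ] Walk E x y l

IsDist : ∀ {n} → Hypergraph n → Fin n → Fin n → ℕ → Set
IsDist E x y d = Walk E x y d × (∀ d' → Walk E x y d' → d ≤ d')

-- Berge hypercycle v₀ e₀ v₁ e₁ … v_{l-1} e_{l-1} v₀, l ≥ 2,
-- with distinct vertices and distinct edges (edges given by their index in E)
record BergeCycle {n} (E : Hypergraph n) : Set where
  field
    len   : ℕ
    len≥2 : 2 ≤ len
    vs    : Fin (suc len) → Fin n
    es    : Fin len → Fin (length E)
    closed : vs (fromℕ len) ≡ vs zero
    vs-inj : Injective _≡_ _≡_ (λ i → vs (inject₁ i))
    es-inj : Injective _≡_ _≡_ es
    inc₁  : ∀ i → vs (inject₁ i) ∈ lookup E (es i)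
    inc₂  : ∀ i → vs (suc i) ∈ lookup E (es i)

Hypertree : ∀ {n} → ℕ → Hypergraph n → Set
Hypertree m E = Simple E × Uniform m E × Connected E × ¬ BergeCycle E

Binary : ∀ {n} → Hypergraph n → Set
Binary {n} E = (w : Fin n) → deg E w ≤ 2

Core : ∀ {n} → Hypergraph n → Fin n → Set
Core E w = deg E w ≡ 1

coreCount : ∀ {n} → Hypergraph n → Subset n → ℕ
coreCount {n} E f = length (filter (λ w → (w ∈? f) ×-dec (deg E w Data.Nat.≟ 1)) (allFin n))

PendentEdge : ∀ {n} → Hypergraph n → Subset n → Set
PendentEdge E f = Any (f ≡_) E × coreCount E f ≡ ∣ f ∣ ∸ 1

PendentVertex : ∀ {n} → Hypergraph n → Fin n → Set
PendentVertex E v = Core E v × ∃[ f ] (PendentEdge E f × v ∈ f)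

image : ∀ {a b} → (Fin a → Fin b) → Subset a → Subset b
image {a} f s = tabulate λ y → any (λ x → lookupᵥ s x ∧ ⌊ f x ≟ᶠ y ⌋) (allFin a)

-- Gluing H (on Fin p) and T (on Fin q) identifying u with vk.
-- Vertex set Fin (p + q); the copy p ↑ʳ vk is left isolated (degree 0).
embH : ∀ {p} q → Fin p → Fin (p + q)
embH q x = x ↑ˡ q

embT : ∀ {p q} → Fin p → Fin q → Fin q → Fin (p + q)
embT {p} {q} u vk x with x ≟ᶠ vk
... | Relation.Nullary.yes _ = u ↑ˡ q
... | Relation.Nullary.no _  = p ↑ʳ x

glue : ∀ {p q} → Hypergraph p → Hypergraph q → Fin p → Fin q → Hypergraph (p + q)
glue {p} {q} EH ET u vk = map (image (embH q)) EH ++ map (image (embT u vk)) ET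

moveEdge : ∀ {p q} → Hypergraph p → (ET : Hypergraph q) → Fin p → Fin q →
           Fin (length ET) → Fin q → Hypergraph (p + q)
moveEdge {p} {q} EH ET u vk i vn =
  map (image (embH q)) EH ++ map (image (embT u vk)) (removeAt ET i)
    ++ (image (embT u vk) ((lookup ET i - vk) ∪ ⁅ vn ⁆) ∷ [])

-- The Zagreb index is a sum of squared degrees, and moving e_k changes degrees only at three
-- kinds of vertex. The glued vertex u = v_k leaves the moved edge, so its degree drops from
-- d = d_H(u) + 2 ≥ 3 to d − 1 and its square by 2d − 1 ≥ 5. The pendent vertex v_n joins that
-- edge, so its degree rises from 1 to at most 2 and its square by at most 3. Any other vertex
-- of the new edge already lay in e_k, so its degree does not increase.
module Submission where

open import Defs
open import Data.Bool using (Bool; T; _∧_; if_then_else_)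
open import Data.Bool.ListAction using (any)
open import Data.Bool.Properties using (T-≡; T-∧)
open import Data.Fin using (Fin; zero; suc; splitAt; _↑ˡ_; _↑ʳ_) renaming (_≟_ to _≟ᶠ_)
open import Data.Fin.Properties using (splitAt-↑ˡ; splitAt-↑ʳ; ↑ˡ-injective; ↑ʳ-injective)
open import Data.Fin.Subset using (Subset; Nonempty; _∈_; _∉_; ∣_∣; _─_; _∪_; ⁅_⁆; inside; outside)
open import Data.Fin.Subset.Properties using (_∈?_; x∈⁅x⁆; x∈⁅y⁆⇒x≡y; x∈p∪q⁻; p─q⊆p)
open import Data.List using (List; []; _∷_; _++_; map; filter; length; lookup; removeAt; allFin; tabulate)
open import Data.List.Properties
  using (filter-++; length-++; length-filter; filter-accept; filter-reject; filter-none; map-tabulate)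
open import Data.List.Membership.Propositional using (lose) renaming (_∈_ to _∈ˡ_)
open import Data.List.Membership.Propositional.Properties using (∈-allFin; ∈-filter⁺; ∈-length; ∈-lookup)
open import Data.List.Relation.Unary.All as All using (universal)
open import Data.List.Relation.Unary.All.Properties using (map⁺)
open import Data.List.Relation.Unary.Any using (here; satisfied)
open import Data.List.Relation.Unary.Any.Properties using (any⁻; any⁺)
open import Data.Nat using (ℕ; zero; suc; _+_; _*_; _≤_; _<_; _>_; z≤n; s≤s; s≤s⁻¹; z<s)
open import Data.Nat.ListAction using () renaming (sum to sumˡ)
open import Data.Nat.Properties
open import Algebra.Properties.CommutativeMonoid.Sum +-0-commutativeMonoid
  using (sum; ∑-distrib-+; sum-replicate-zero)
open import Data.Nat.Tactic.RingSolver using (solve-∀)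
open import Data.Product using (∃-syntax; _×_; _,_)
open import Data.Sum using (inj₁; inj₂)
open import Data.Vec using (_∷_; here; there) renaming (lookup to lookupᵥ)
open import Data.Vec.Properties using (lookup∘tabulate; []=⇒lookup; lookup⇒[]=)
open import Function using (_∘_)
open import Function.Bundles using (Equivalence)
open import Function.Definitions using (Injective)
open import Relation.Binary.PropositionalEquality
open import Relation.Nullary using (yes; no; does; contradiction)
open import Relation.Nullary.Decidable using (⌊_⌋; toWitness; fromWitness)

open Equivalence using (to; from)

x∈p─q⇒x∉q : ∀ {n} (p q : Subset n) {x} → x ∈ p ─ q → x ∉ q
x∈p─q⇒x∉q (inside ∷ p) (outside ∷ q) here ()
x∈p─q⇒x∉q (_ ∷ p) (_ ∷ q) (there x∈p─q) (there x∈q) = x∈p─q⇒x∉q p q x∈p─q x∈q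

x∈p⇒0<∣p∣ : ∀ {n} {p : Subset n} {x} → x ∈ p → 0 < ∣ p ∣
x∈p⇒0<∣p∣ {p = inside ∷ p} _ = z<s
x∈p⇒0<∣p∣ {p = outside ∷ p} (there x∈p) = x∈p⇒0<∣p∣ x∈p

0<∣p∣⇒Nonempty : ∀ {n} (p : Subset n) → 0 < ∣ p ∣ → Nonempty p
0<∣p∣⇒Nonempty (inside ∷ p) _ = zero , here
0<∣p∣⇒Nonempty (outside ∷ p) 0<∣p∣
  with x , x∈p ← 0<∣p∣⇒Nonempty p 0<∣p∣ = suc x , there x∈p

module _ {a b} (f : Fin a → Fin b) where
  private
    hits : Subset a → Fin b → Fin a → Bool
    hits s y x = lookupᵥ s x ∧ ⌊ f x ≟ᶠ y ⌋

  ∈-image⁺ : ∀ {s x} → x ∈ s → f x ∈ image f s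
  ∈-image⁺ {s} {x} x∈s = lookup⇒[]= (f x) (image f s)
    (trans (lookup∘tabulate (λ y → any (hits s y) (allFin a)) (f x))
           (to T-≡ (any⁺ (hits s (f x)) (lose (∈-allFin x) hit))))
    where
    hit : T (hits s (f x) x)
    hit = from T-∧ (from T-≡ ([]=⇒lookup x∈s) , fromWitness refl)

  ∈-image⁻ : ∀ {s y} → y ∈ image f s → ∃[ x ] (x ∈ s × f x ≡ y)
  ∈-image⁻ {s} {y} y∈
    with x , hit ← satisfied (any⁻ (hits s y) (allFin a) (from T-≡
                     (trans (sym (lookup∘tabulate (λ y → any (hits s y) (allFin a)) y))
                            ([]=⇒lookup y∈))))
    with x∈s , fx≡y ← to (T-∧ {lookupᵥ s x} {⌊ f x ≟ᶠ y ⌋}) hit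
    = x , lookup⇒[]= x s (to T-≡ x∈s) , toWitness {a? = f x ≟ᶠ y} fx≡y

  ∈-image-injective : Injective _≡_ _≡_ f → ∀ {s x} → f x ∈ image f s → x ∈ s
  ∈-image-injective f-inj {s} fx∈ with x′ , x′∈s , fx′≡fx ← ∈-image⁻ fx∈ =
    subst (_∈ s) (f-inj fx′≡fx) x′∈s

  ∉-image : ∀ {s y} → (∀ x → f x ≢ y) → y ∉ image f s
  ∉-image {s} y∉ran y∈ with x , _ , fx≡y ← ∈-image⁻ {s} y∈ = y∉ran x fx≡y

module _ {n : ℕ} where

  deg-++ : (E F : Hypergraph n) (w : Fin n) → deg (E ++ F) w ≡ deg E w + deg F w
  deg-++ E F w = trans (cong length (filter-++ (w ∈?_) E F)) (length-++ (filter (w ∈?_) E))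

  deg-singleton-≤1 : ∀ e (w : Fin n) → deg (e ∷ []) w ≤ 1
  deg-singleton-≤1 e w = length-filter (w ∈?_) (e ∷ [])

  deg-singleton-∈ : ∀ {e} {w : Fin n} → w ∈ e → deg (e ∷ []) w ≡ 1
  deg-singleton-∈ {w = w} w∈e = cong length (filter-accept (w ∈?_) w∈e)

  deg-singleton-∉ : ∀ {e} {w : Fin n} → w ∉ e → deg (e ∷ []) w ≡ 0
  deg-singleton-∉ {w = w} w∉e = cong length (filter-reject (w ∈?_) w∉e)

  deg-singleton-mono : ∀ {e e′} {w : Fin n} → (w ∈ e → w ∈ e′) →
    deg (e ∷ []) w ≤ deg (e′ ∷ []) w
  deg-singleton-mono {e} {w = w} e⊆e′ with w ∈? e
  ... | yes w∈e = ≤-reflexive (sym (deg-singleton-∈ (e⊆e′ w∈e)))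
  ... | no _ = z≤n

  deg-map-removeAt : ∀ {A : Set} (g : A → Subset n) (xs : List A) (i : Fin (length xs)) w →
    deg (map g xs) w ≡ deg (map g (removeAt xs i)) w + deg (g (lookup xs i) ∷ []) w
  deg-map-removeAt g (x ∷ xs) zero w = trans (deg-++ (g x ∷ []) (map g xs) w)
                                         (+-comm (deg (g x ∷ []) w) (deg (map g xs) w))
  deg-map-removeAt g (x ∷ xs) (suc i) w = begin
    deg (map g (x ∷ xs)) w
      ≡⟨ deg-++ (g x ∷ []) (map g xs) w ⟩
    deg (g x ∷ []) w + deg (map g xs) w
      ≡⟨ cong (deg (g x ∷ []) w +_) (deg-map-removeAt g xs i w) ⟩
    deg (g x ∷ []) w + (deg (map g (removeAt xs i)) w + deg (g (lookup xs i) ∷ []) w)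
      ≡⟨ +-assoc (deg (g x ∷ []) w) (deg (map g (removeAt xs i)) w) _ ⟨
    deg (g x ∷ []) w + deg (map g (removeAt xs i)) w + deg (g (lookup xs i) ∷ []) w
      ≡⟨ cong (_+ deg (g (lookup xs i) ∷ []) w) (deg-++ (g x ∷ []) (map g (removeAt xs i)) w) ⟨
    deg (map g (x ∷ removeAt xs i)) w + deg (g (lookup xs i) ∷ []) w ∎
    where open ≡-Reasoning

  deg-pos : ∀ {E : Hypergraph n} {e w} → e ∈ˡ E → w ∈ e → 0 < deg E w
  deg-pos {w = w} e∈E w∈e = ∈-length (∈-filter⁺ (w ∈?_) e∈E w∈e)

  connected⇒deg-pos : ∀ {m} {E : Hypergraph n} → Connected E → Uniform m E →
    0 < m → 0 < length E → ∀ u → 0 < deg E u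
  connected⇒deg-pos {E = e ∷ E} conn (∣e∣≡m All.∷ _) 0<m _ u
    with x , x∈e ← 0<∣p∣⇒Nonempty e (subst (0 <_) (sym ∣e∣≡m) 0<m)
    with conn u x
  ... | _ , here = deg-pos (here refl) x∈e
  ... | _ , step _ e′∈E u∈e′ _ _ = deg-pos e′∈E u∈e′

module _ {a b : ℕ} (f : Fin a → Fin b) where

  deg-map-image : Injective _≡_ _≡_ f → (E : Hypergraph a) (x : Fin a) →
    deg (map (image f) E) (f x) ≡ deg E x
  deg-map-image f-inj [] x = refl
  deg-map-image f-inj (e ∷ E) x with f x ∈? image f e | x ∈? e
  ... | yes _ | yes _ = cong suc (deg-map-image f-inj E x)
  ... | no _ | no _ = deg-map-image f-inj E x
  ... | yes fx∈ | no x∉e = contradiction (∈-image-injective f f-inj fx∈) x∉e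
  ... | no fx∉ | yes x∈e = contradiction (∈-image⁺ f x∈e) fx∉

  deg-map-image-outside : ∀ {y} → (∀ x → f x ≢ y) → (E : Hypergraph a) →
    deg (map (image f) E) y ≡ 0
  deg-map-image-outside {y} y∉ran E =
    cong length (filter-none (y ∈?_) (map⁺ (universal (λ e → ∉-image f {e} y∉ran) E)))

point : ∀ {n} → Fin n → ℕ → Fin n → ℕ
point a k w = if does (a ≟ᶠ w) then k else 0

sum-point : ∀ {n} (a : Fin n) k → sum (point a k) ≡ k
sum-point {suc n} zero k = trans (cong (k +_) (sum-replicate-zero n)) (+-identityʳ k)
sum-point {suc n} (suc a) k = sum-point a k

sum-mono-≤ : ∀ {n} {f g : Fin n → ℕ} → (∀ w → f w ≤ g w) → sum f ≤ sum g
sum-mono-≤ {zero} _ = z≤n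
sum-mono-≤ {suc n} f≤g = +-mono-≤ (f≤g zero) (sum-mono-≤ (f≤g ∘ suc))

sum-transfer : ∀ {n} (f g : Fin n → ℕ) {a b : Fin n} {s t : ℕ} → a ≢ b →
  f a + s ≤ g a → f b ≤ g b + t → (∀ w → w ≢ a → w ≢ b → f w ≤ g w) →
  sum f + s ≤ sum g + t
sum-transfer f g {a} {b} {s} {t} a≢b at-a at-b elsewhere = begin
  sum f + s                                ≡⟨ cong (sum f +_) (sum-point a s) ⟨
  sum f + sum (point a s)                  ≡⟨ ∑-distrib-+ f (point a s) ⟨
  sum (λ w → f w + point a s w)            ≤⟨ sum-mono-≤ pointwise ⟩
  sum (λ w → g w + point b t w)            ≡⟨ ∑-distrib-+ g (point b t) ⟩
  sum g + sum (point b t)                  ≡⟨ cong (sum g +_) (sum-point b t) ⟩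
  sum g + t                                ∎
  where
  open ≤-Reasoning
  pointwise : ∀ w → f w + point a s w ≤ g w + point b t w
  pointwise w with a ≟ᶠ w | b ≟ᶠ w
  ... | yes refl | yes refl = contradiction refl a≢b
  ... | yes refl | no _ = ≤-trans at-a (m≤m+n (g a) 0)
  ... | no _ | yes refl = ≤-trans (≤-reflexive (+-identityʳ (f b))) at-b
  ... | no a≢w | no b≢w = +-monoˡ-≤ 0 (elsewhere w (a≢w ∘ sym) (b≢w ∘ sym))

sumˡ-tabulate : ∀ {n} (h : Fin n → ℕ) → sumˡ (tabulate h) ≡ sum h
sumˡ-tabulate {zero} h = refl
sumˡ-tabulate {suc n} h = cong (h zero +_) (sumˡ-tabulate (h ∘ suc))

Zagreb-as-sum : ∀ {n} (E : Hypergraph n) → Zagreb E ≡ sum (λ w → deg E w * deg E w)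
Zagreb-as-sum {n} E = trans (cong sumˡ (map-tabulate (λ w → w) square)) (sumˡ-tabulate square)
  where
  square : Fin n → ℕ
  square w = deg E w * deg E w

square-suc : ∀ {d} → 2 ≤ d → d * d + 5 ≤ suc d * suc d
square-suc {suc (suc k)} (s≤s (s≤s _)) = ≤-trans (m≤m+n _ (2 * k)) (≤-reflexive (expand k))
  where
  expand : ∀ k → (2 + k) * (2 + k) + 5 + 2 * k ≡ (3 + k) * (3 + k)
  expand = solve-∀

m+5≤n+3⇒m<n : ∀ {m n} → m + 5 ≤ n + 3 → m < n
m+5≤n+3⇒m<n {m} {n} m+5≤n+3 = +-cancelʳ-≤ 3 (suc m) n
  (≤-trans (≤-reflexive (sym (+-suc m 3))) (≤-trans (+-monoʳ-≤ m (n≤1+n 4)) m+5≤n+3))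

↑ˡ≢↑ʳ : ∀ {p q} (x : Fin p) (y : Fin q) → x ↑ˡ q ≢ p ↑ʳ y
↑ˡ≢↑ʳ {p} {q} x y eq = contradiction
  (trans (sym (splitAt-↑ˡ p x q)) (trans (cong (splitAt p) eq) (splitAt-↑ʳ p q y))) λ ()

module Gluing {p q : ℕ} (u : Fin p) (vk : Fin q) where

  embT-vk : embT u vk vk ≡ u ↑ˡ q
  embT-vk with vk ≟ᶠ vk
  ... | yes _ = refl
  ... | no vk≢vk = contradiction refl vk≢vk

  embT-≢ : ∀ {x} → x ≢ vk → embT u vk x ≡ p ↑ʳ x
  embT-≢ {x} x≢vk with x ≟ᶠ vk
  ... | yes x≡vk = contradiction x≡vk x≢vk
  ... | no _ = refl

  embT-injective : Injective _≡_ _≡_ (embT u vk)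
  embT-injective {x} {y} eq with x ≟ᶠ vk | y ≟ᶠ vk
  ... | yes refl | yes refl = refl
  ... | yes _ | no _ = contradiction eq (↑ˡ≢↑ʳ u y)
  ... | no _ | yes _ = contradiction (sym eq) (↑ˡ≢↑ʳ u x)
  ... | no _ | no _ = ↑ʳ-injective p x y eq

module EdgeMove {p q : ℕ} (EH : Hypergraph p) (ET : Hypergraph q) (u : Fin p)
                (vk vn : Fin q) (ek : Fin (length ET)) where
  open Gluing u vk

  H₁ H₂ : Hypergraph (p + q)
  H₁ = glue EH ET u vk
  H₂ = moveEdge EH ET u vk ek vn

  glued pendent : Fin (p + q)
  glued = u ↑ˡ q
  pendent = p ↑ʳ vn

  old new : Subset q
  old = lookup ET ek
  new = (old ─ ⁅ vk ⁆) ∪ ⁅ vn ⁆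

  liftT : Subset q → Subset (p + q)
  liftT = image (embT u vk)

  degH degT degR : Fin (p + q) → ℕ
  degH = deg (map (image (embH q)) EH)
  degT = deg (map liftT ET)
  degR = deg (map liftT (removeAt ET ek))

  deg-H₁ : ∀ w → deg H₁ w ≡ degH w + degT w
  deg-H₁ = deg-++ (map (image (embH q)) EH) (map liftT ET)

  deg-H₂ : ∀ w → deg H₂ w ≡ degH w + (degR w + deg (liftT new ∷ []) w)
  deg-H₂ w = trans (deg-++ (map (image (embH q)) EH) _ w)
    (cong (degH w +_) (deg-++ (map liftT (removeAt ET ek)) _ w))

  degT-removeAt : ∀ w → degT w ≡ degR w + deg (liftT old ∷ []) w
  degT-removeAt = deg-map-removeAt liftT ET ek

  deg-H₂≤suc-deg-H₁ : ∀ w → deg H₂ w ≤ suc (deg H₁ w)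
  deg-H₂≤suc-deg-H₁ w = begin
    deg H₂ w                                    ≡⟨ deg-H₂ w ⟩
    degH w + (degR w + deg (liftT new ∷ []) w)
      ≤⟨ +-monoʳ-≤ (degH w) (+-mono-≤ degR≤degT (deg-singleton-≤1 (liftT new) w)) ⟩
    degH w + (degT w + 1)                       ≡⟨ +-assoc (degH w) (degT w) 1 ⟨
    degH w + degT w + 1                         ≡⟨ cong (_+ 1) (deg-H₁ w) ⟨
    deg H₁ w + 1                                ≡⟨ +-comm (deg H₁ w) 1 ⟩
    suc (deg H₁ w)                              ∎
    where
    open ≤-Reasoning
    degR≤degT : degR w ≤ degT w
    degR≤degT = ≤-trans (m≤m+n (degR w) _) (≤-reflexive (sym (degT-removeAt w)))

  deg-H₁-glued : deg H₁ glued ≡ deg EH u + deg ET vk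
  deg-H₁-glued = begin
    deg H₁ glued                      ≡⟨ deg-H₁ glued ⟩
    degH glued + degT glued           ≡⟨ cong (degH glued +_) (cong degT embT-vk) ⟨
    degH glued + degT (embT u vk vk)  ≡⟨ cong₂ _+_ (deg-map-image (embH q) (↑ˡ-injective q _ _) EH u)
                                                   (deg-map-image (embT u vk) embT-injective ET vk) ⟩
    deg EH u + deg ET vk              ∎
    where open ≡-Reasoning

  deg-H₁-right : ∀ {x} → x ≢ vk → deg H₁ (p ↑ʳ x) ≡ deg ET x
  deg-H₁-right {x} x≢vk = begin
    deg H₁ (p ↑ʳ x)                ≡⟨ deg-H₁ (p ↑ʳ x) ⟩
    degH (p ↑ʳ x) + degT (p ↑ʳ x)  ≡⟨ cong₂ _+_ (deg-map-image-outside (embH q) (λ y → ↑ˡ≢↑ʳ y x) EH)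
                                                (cong degT (sym (embT-≢ x≢vk))) ⟩
    0 + degT (embT u vk x)         ≡⟨ deg-map-image (embT u vk) embT-injective ET x ⟩
    deg ET x                       ∎
    where open ≡-Reasoning

  module _ (vk∈old : vk ∈ old) (vn≢vk : vn ≢ vk) where

    vk∉new : vk ∉ new
    vk∉new vk∈new with x∈p∪q⁻ (old ─ ⁅ vk ⁆) ⁅ vn ⁆ vk∈new
    ... | inj₁ vk∈old─vk = x∈p─q⇒x∉q old ⁅ vk ⁆ vk∈old─vk (x∈⁅x⁆ vk)
    ... | inj₂ vk∈⁅vn⁆ = vn≢vk (sym (x∈⁅y⁆⇒x≡y vn vk∈⁅vn⁆))

    suc-deg-H₂-glued : suc (deg H₂ glued) ≡ deg H₁ glued
    suc-deg-H₂-glued = begin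
      suc (deg H₂ glued)
        ≡⟨ cong suc (deg-H₂ glued) ⟩
      suc (degH glued + (degR glued + deg (liftT new ∷ []) glued))
        ≡⟨ cong (λ k → suc (degH glued + (degR glued + k))) (deg-singleton-∉ glued∉new) ⟩
      suc (degH glued + (degR glued + 0))
        ≡⟨ shift (degH glued) (degR glued) ⟩
      degH glued + (degR glued + 1)
        ≡⟨ cong (λ k → degH glued + (degR glued + k)) (deg-singleton-∈ glued∈old) ⟨
      degH glued + (degR glued + deg (liftT old ∷ []) glued)
        ≡⟨ cong (degH glued +_) (degT-removeAt glued) ⟨
      degH glued + degT glued
        ≡⟨ deg-H₁ glued ⟨
      deg H₁ glued ∎
      where
      open ≡-Reasoning
      shift : ∀ a b → suc (a + (b + 0)) ≡ a + (b + 1)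
      shift = solve-∀
      glued∈old : glued ∈ liftT old
      glued∈old = subst (_∈ liftT old) embT-vk (∈-image⁺ (embT u vk) vk∈old)
      glued∉new : glued ∉ liftT new
      glued∉new glued∈new = vk∉new (∈-image-injective (embT u vk) embT-injective
        (subst (_∈ liftT new) (sym embT-vk) glued∈new))

    deg-H₂≤deg-H₁ : ∀ w → w ≢ pendent → deg H₂ w ≤ deg H₁ w
    deg-H₂≤deg-H₁ w w≢vn = begin
      deg H₂ w                                    ≡⟨ deg-H₂ w ⟩
      degH w + (degR w + deg (liftT new ∷ []) w)
        ≤⟨ +-monoʳ-≤ (degH w) (+-monoʳ-≤ (degR w) (deg-singleton-mono new⊆old)) ⟩
      degH w + (degR w + deg (liftT old ∷ []) w)  ≡⟨ cong (degH w +_) (degT-removeAt w) ⟨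
      degH w + degT w                             ≡⟨ deg-H₁ w ⟨
      deg H₁ w                                    ∎
      where
      open ≤-Reasoning
      new⊆old : w ∈ liftT new → w ∈ liftT old
      new⊆old w∈new with x , x∈new , embT-x≡w ← ∈-image⁻ (embT u vk) w∈new
        with x∈p∪q⁻ (old ─ ⁅ vk ⁆) ⁅ vn ⁆ x∈new
      ... | inj₁ x∈old─vk = subst (_∈ liftT old) embT-x≡w
                              (∈-image⁺ (embT u vk) (p─q⊆p old ⁅ vk ⁆ x∈old─vk))
      ... | inj₂ x∈⁅vn⁆ = contradiction
        (trans (sym embT-x≡w) (trans (cong (embT u vk) (x∈⁅y⁆⇒x≡y vn x∈⁅vn⁆)) (embT-≢ vn≢vk)))
        w≢vn

    Zagreb-H₂<Zagreb-H₁ : 0 < deg EH u → deg ET vk ≡ 2 → deg ET vn ≡ 1 → Zagreb H₂ < Zagreb H₁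
    Zagreb-H₂<Zagreb-H₁ 0<deg-u deg-vk≡2 deg-vn≡1 =
      m+5≤n+3⇒m<n (subst₂ (λ z₂ z₁ → z₂ + 5 ≤ z₁ + 3)
        (sym (Zagreb-as-sum H₂)) (sym (Zagreb-as-sum H₁))
        (sum-transfer (λ w → deg H₂ w * deg H₂ w) (λ w → deg H₁ w * deg H₁ w)
          (↑ˡ≢↑ʳ u vn) at-glued at-pendent elsewhere))
      where
      2≤deg₂-glued : 2 ≤ deg H₂ glued
      2≤deg₂-glued = s≤s⁻¹ (begin
        3                     ≤⟨ +-monoˡ-≤ 2 0<deg-u ⟩
        deg EH u + 2          ≡⟨ cong (deg EH u +_) deg-vk≡2 ⟨
        deg EH u + deg ET vk  ≡⟨ deg-H₁-glued ⟨
        deg H₁ glued          ≡⟨ suc-deg-H₂-glued ⟨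
        suc (deg H₂ glued)    ∎)
        where open ≤-Reasoning
      at-glued : deg H₂ glued * deg H₂ glued + 5 ≤ deg H₁ glued * deg H₁ glued
      at-glued = subst (λ d → deg H₂ glued * deg H₂ glued + 5 ≤ d * d) suc-deg-H₂-glued
                   (square-suc 2≤deg₂-glued)
      deg₁-pendent≡1 : deg H₁ pendent ≡ 1
      deg₁-pendent≡1 = trans (deg-H₁-right vn≢vk) deg-vn≡1
      deg₂-pendent≤2 : deg H₂ pendent ≤ 2
      deg₂-pendent≤2 = subst (λ d → deg H₂ pendent ≤ suc d) deg₁-pendent≡1
                         (deg-H₂≤suc-deg-H₁ pendent)
      at-pendent : deg H₂ pendent * deg H₂ pendent ≤ deg H₁ pendent * deg H₁ pendent + 3
      at-pendent = subst (λ d → deg H₂ pendent * deg H₂ pendent ≤ d * d + 3) (sym deg₁-pendent≡1)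
                     (*-mono-≤ deg₂-pendent≤2 deg₂-pendent≤2)
      elsewhere : ∀ w → w ≢ glued → w ≢ pendent → deg H₂ w * deg H₂ w ≤ deg H₁ w * deg H₁ w
      elsewhere w _ w≢vn = *-mono-≤ (deg-H₂≤deg-H₁ w w≢vn) (deg-H₂≤deg-H₁ w w≢vn)

lemma2p4 : (m p q : ℕ) (EH : Hypergraph p) (ET : Hypergraph q)
    → Simple EH → Uniform m EH → Connected EH → 1 ≤ length EH
    → (u : Fin p)
    → Hypertree m ET → Binary ET
    → (vk vn u₁ u₂ : Fin q) (ek ek₁ : Fin (length ET))
    → ek ≢ ek₁
    → deg ET vk ≡ 2
    → vk ∈ lookup ET ek → u₁ ∈ lookup ET ek
    → vk ∈ lookup ET ek₁ → u₂ ∈ lookup ET ek₁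
    → u₁ ≢ vk → u₂ ≢ vk
    → PendentVertex ET vn
    → (∃[ d₁ ] ∃[ d₂ ] (IsDist ET u₁ vn d₁ × IsDist ET u₂ vn d₂ × d₁ > d₂))
    → Zagreb (glue EH ET u vk) > Zagreb (moveEdge EH ET u vk ek vn)
lemma2p4 m p q EH ET _ uniH connH 0<∣EH∣ u (_ , uniT , _ , _) _ vk vn _ _ ek _ _
         deg-vk≡2 vk∈ek _ _ _ _ _ (deg-vn≡1 , _) _ =
  Zagreb-H₂<Zagreb-H₁ vk∈ek vn≢vk 0<deg-u deg-vk≡2 deg-vn≡1
  where
  open EdgeMove EH ET u vk vn ek
  vn≢vk : vn ≢ vk
  vn≢vk refl = contradiction (trans (sym deg-vn≡1) deg-vk≡2) λ ()
  0<m : 0 < m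
  0<m = subst (0 <_) (All.lookup uniT (∈-lookup ek)) (x∈p⇒0<∣p∣ vk∈ek)
  0<deg-u : 0 < deg EH u
  0<deg-u = connected⇒deg-pos connH uniH 0<m 0<∣EH∣ u
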